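{- Let $\bar k$ be an even positive integer and let $\varphi$ be a $\bar k$-wise uniform distribution on $\{ -1,1\}^n$. If $m_1^2\le\frac{t^{\bar k}}{5\,\bar k^{\bar k/2}}$, then the Filter Test with parameters $m_1$ and $t$ accepts $\varphi$ with probability at least $0.9$.
   Context: Distributions on $\{ -1,1\}^n$ are identified with densities $\varphi\ge0$ with $\mathbb{E}_{x\sim\{ -1,1\}^n}[\varphi(x)]=1$; $\varphi$ is $\bar k$-wise uniform iff $\mathbb{E}_{x\sim\{ -1,1\}^n}[\varphi(x)\prod_{i\in S}x_i]=0$ for all $1\le|S|\le\bar k$. Filter Test (parameters $m_1$, $t>0$): draw $m_1$ independent samples from $\varphi$; if there exists a pair of samples $x,y$ with $\left|\sum_{i=1}^n x_iy_i\right|>t\sqrt n$, output "Reject"; otherwise output "Accept".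
   Formalization: The density φ of the distribution takes rational values, and the parameter t of the Filter Test is rational. -}

module Defs where

open import Data.Bool using (Bool; true; false; if_then_else_; _∧_; not)
import Data.Vec
open import Data.Bool.ListAction using (and)
open import Data.Nat as ℕ using (ℕ; zero; suc)
open import Data.Integer as ℤ using (ℤ; +_)
open import Data.Rational as ℚ using (ℚ; 0ℚ; 1ℚ; _≤_; _<_; _≤ᵇ_)
open import Data.Fin using (Fin; zero; suc; _<?_)
open import Data.Fin.Subset using (Subset; inside; outside; ∣_∣)
open import Data.Vec using (Vec; []; _∷_; lookup)
open import Data.List as List using (List; []; _∷_; concatMap; map; foldr)
open import Relation.Nullary.Decidable using (⌊_⌋)
open import Relation.Binary.PropositionalEquality using (_≡_)

-- A point of the hypercube {-1,1}^n : true ↦ +1, false ↦ -1.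
Cube : ℕ → Set
Cube n = Vec Bool n

sgn : Bool → ℤ
sgn true  = + 1
sgn false = ℤ.- (+ 1)

allCube : (n : ℕ) → List (Cube n)
allCube zero    = [] ∷ []
allCube (suc n) = concatMap (λ x → (true ∷ x) ∷ (false ∷ x) ∷ []) (allCube n)

tuples : {A : Set} → List A → (m : ℕ) → List (Vec A m)
tuples xs zero    = [] ∷ []
tuples xs (suc m) = concatMap (λ x → map (x ∷_) (tuples xs m)) xs

sumℚ : List ℚ → ℚ
sumℚ = foldr ℚ._+_ 0ℚ

prodℚ : {m : ℕ} → Vec ℚ m → ℚ
prodℚ []       = 1ℚ
prodℚ (q ∷ qs) = q ℚ.* prodℚ qs

_^ℚ_ : ℚ → ℕ → ℚ
q ^ℚ zero  = 1ℚ
q ^ℚ suc k = q ℚ.* (q ^ℚ k)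

inv2^ : ℕ → ℚ
inv2^ zero    = 1ℚ
inv2^ (suc n) = ((+ 1) ℚ./ 2) ℚ.* inv2^ n

E : (n : ℕ) → (Cube n → ℚ) → ℚ
E n f = sumℚ (map f (allCube n)) ℚ.* inv2^ n

χ : {n : ℕ} → Subset n → Cube n → ℤ
χ []            []       = + 1
χ (inside ∷ S)  (b ∷ x)  = sgn b ℤ.* χ S x
χ (outside ∷ S) (b ∷ x)  = χ S x

record IsDensity (n : ℕ) (φ : Cube n → ℚ) : Set where
  field
    nonneg : ∀ x → 0ℚ ≤ φ x
    normalised : E n φ ≡ 1ℚ

KWiseUniform : (n k : ℕ) → (Cube n → ℚ) → Set
KWiseUniform n k φ = (S : Subset n) → 1 ℕ.≤ ∣ S ∣ → ∣ S ∣ ℕ.≤ k →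
                     E n (λ x → φ x ℚ.* (χ S x ℚ./ 1)) ≡ 0ℚ

inner : {n : ℕ} → Cube n → Cube n → ℤ
inner []       []       = + 0
inner (a ∷ x) (b ∷ y) = sgn a ℤ.* sgn b ℤ.+ inner x y

-- The pair (x,y) is "far":  |Σ x_i y_i| > t √n, written (for t > 0) as
-- (Σ x_i y_i)^2 > t^2 n.
far : (n : ℕ) (t : ℚ) → Cube n → Cube n → Bool
far n t x y = not ((inner x y ℚ./ 1) ^ℚ 2 ≤ᵇ (t ^ℚ 2) ℚ.* (+ n ℚ./ 1))

accepts : (n : ℕ) (t : ℚ) {m : ℕ} → Vec (Cube n) m → Bool
accepts n t {m} s = allPairs (List.allFin m)
  where
  allPairs : List (Fin m) → Bool
  allPairs is = and (map (λ i → and (map (λ j →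
                  not (⌊ i <? j ⌋ ∧ far n t (lookup s i) (lookup s j))) is)) is)

-- Probability that the Filter Test with parameters m₁, t accepts the
-- distribution with density φ (m₁ independent samples, x has mass φ x / 2^n).
acceptProb : (n : ℕ) (φ : Cube n → ℚ) (m₁ : ℕ) (t : ℚ) → ℚ
acceptProb n φ m₁ t =
  sumℚ (map (λ s → if accepts n t s
                   then prodℚ (Data.Vec.map (λ x → φ x ℚ.* inv2^ n) s)
                   else 0ℚ)
            (tuples (allCube n) m₁))

{-# OPTIONS --safe #-}
-- Let q be the probability that two independent samples x, y are far.  By the
-- union bound over the m₁² ordered pairs of samples, the test rejects with
-- probability at most m₁² q.  Markov's inequality for ⟨x,y⟩^k gives
-- q (t² n)^(k/2) ≤ E⟨x,y⟩^k, and expanding the power,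
-- E⟨x,y⟩^k = Σ_{I ∈ [n]^k} (E χ_(parity I))², where parity I is the set of indices
-- occurring an odd number of times in I.  Since |parity I| ≤ k, k-wise uniformity
-- leaves only the I of empty parity, and there are at most (k-1)!! n^(k/2) of
-- them.  Hence 2 q t^k ≤ 2 (k-1)!! ≤ k^(k/2), and m₁² q ≤ 1/10 by hypothesis.
module Submission where

open import Defs
open import Data.Nat using (ℕ; _/_; _^_) renaming (_*_ to _*ℕ_; _<_ to _<ℕ_)
open import Data.Nat.Divisibility using (_∣_; divides)
open import Data.Nat.DivMod using (m*n/n≡m)
open import Data.Integer using (+_)
open import Data.Rational using (ℚ; 0ℚ; _≤_; _<_) renaming (_/_ to _/ℚ_)

open import Data.Bool using (Bool; true; false; not; _∧_; if_then_else_; T)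
import Data.Bool.Properties as Bool
open import Data.Bool.ListAction using (and)
open import Data.Empty using (⊥-elim)
open import Data.Fin as Fin using (Fin; zero; suc; _<?_)
import Data.Fin.Properties as Fin
open import Data.Fin.Subset using (Subset; ⊥; ∣_∣; _∈_)
import Data.Fin.Subset.Properties as Subset
import Data.Integer as ℤ
import Data.Integer.Properties as ℤ
open import Data.List as List using (List; []; _∷_; _++_; map; concatMap; allFin)
import Data.List.Properties as List
import Data.Nat as ℕ
import Data.Nat.Properties as ℕ
import Algebra.Properties.CommutativeSemigroup ℕ.*-commutativeSemigroup as ℕ*
open import Data.Rational using (1ℚ; _+_; _*_; -_; _-_; _≤ᵇ_; toℚᵘ; nonNegative; nonPositive; positive)
import Data.Rational.Properties as ℚ
open import Data.Rational.Solver using (module +-*-Solver)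
import Data.Rational.Unnormalised as ℚᵘ
import Data.Rational.Unnormalised.Properties as ℚᵘ
open import Data.Sum using (inj₁; inj₂)
open import Data.Vec as Vec using (Vec; []; _∷_; lookup; here; there)
import Data.Vec.Properties as Vec
open import Function using (_∘_)
open import Relation.Binary.PropositionalEquality
open import Relation.Nullary.Decidable using (Dec; does; ⌊_⌋; yes; no; dec-true; dec-false)

open +-*-Solver

private
  variable
    A B : Set
    m n : ℕ

ι : ℤ.ℤ → ℚ
ι z = z /ℚ 1

ιℕ : ℕ → ℚ
ιℕ n = ι (+ n)

private
  toℚᵘ-ι : ∀ a → toℚᵘ (ι a) ℚᵘ.≃ ℚᵘ.mkℚᵘ a 0
  toℚᵘ-ι a = ℚ.toℚᵘ-fromℚᵘ (ℚᵘ.mkℚᵘ a 0)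

ι-+ : ∀ a b → ι (a ℤ.+ b) ≡ ι a + ι b
ι-+ a b = ℚ.toℚᵘ-injective (begin
  toℚᵘ (ι (a ℤ.+ b))              ≈⟨ toℚᵘ-ι (a ℤ.+ b) ⟩
  ℚᵘ.mkℚᵘ (a ℤ.+ b) 0             ≈⟨ ℚᵘ.*≡* (cong (ℤ._* + 1) (sym (cong₂ ℤ._+_ (ℤ.*-identityʳ a) (ℤ.*-identityʳ b)))) ⟩
  ℚᵘ.mkℚᵘ a 0 ℚᵘ.+ ℚᵘ.mkℚᵘ b 0    ≈⟨ ℚᵘ.+-cong (ℚᵘ.≃-sym (toℚᵘ-ι a)) (ℚᵘ.≃-sym (toℚᵘ-ι b)) ⟩
  toℚᵘ (ι a) ℚᵘ.+ toℚᵘ (ι b)      ≈⟨ ℚᵘ.≃-sym (ℚ.toℚᵘ-homo-+ (ι a) (ι b)) ⟩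
  toℚᵘ (ι a + ι b)                ∎)
  where open ℚᵘ.≃-Reasoning

ι-* : ∀ a b → ι (a ℤ.* b) ≡ ι a * ι b
ι-* a b = ℚ.toℚᵘ-injective (begin
  toℚᵘ (ι (a ℤ.* b))              ≈⟨ toℚᵘ-ι (a ℤ.* b) ⟩
  ℚᵘ.mkℚᵘ (a ℤ.* b) 0             ≈⟨ ℚᵘ.*-cong (ℚᵘ.≃-sym (toℚᵘ-ι a)) (ℚᵘ.≃-sym (toℚᵘ-ι b)) ⟩
  toℚᵘ (ι a) ℚᵘ.* toℚᵘ (ι b)      ≈⟨ ℚᵘ.≃-sym (ℚ.toℚᵘ-homo-* (ι a) (ι b)) ⟩
  toℚᵘ (ι a * ι b)                ∎)
  where open ℚᵘ.≃-Reasoning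

ι-mono-≤ : ∀ {a b} → a ℤ.≤ b → ι a ≤ ι b
ι-mono-≤ {a} {b} a≤b = ℚ.toℚᵘ-cancel-≤ (begin
  toℚᵘ (ι a)    ≃⟨ toℚᵘ-ι a ⟩
  ℚᵘ.mkℚᵘ a 0   ≤⟨ ℚᵘ.*≤* (ℤ.*-monoʳ-≤-nonNeg (+ 1) a≤b) ⟩
  ℚᵘ.mkℚᵘ b 0   ≃⟨ toℚᵘ-ι b ⟨
  toℚᵘ (ι b)    ∎)
  where open ℚᵘ.≤-Reasoning

ιℕ-mono-≤ : m ℕ.≤ n → ιℕ m ≤ ιℕ n
ιℕ-mono-≤ m≤n = ι-mono-≤ (ℤ.+≤+ m≤n)

ιℕ-nonneg : ∀ n → 0ℚ ≤ ιℕ n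
ιℕ-nonneg n = ιℕ-mono-≤ {0} {n} ℕ.z≤n

ιℕ-suc : ∀ n → ιℕ (ℕ.suc n) ≡ 1ℚ + ιℕ n
ιℕ-suc n = ι-+ (+ 1) (+ n)

ιℕ-* : ∀ m n → ιℕ (m *ℕ n) ≡ ιℕ m * ιℕ n
ιℕ-* m n = trans (cong ι (ℤ.pos-* m n)) (ι-* (+ m) (+ n))

ιℕ-^ : ∀ m j → ιℕ (m ^ j) ≡ ιℕ m ^ℚ j
ιℕ-^ m ℕ.zero    = refl
ιℕ-^ m (ℕ.suc j) = trans (ιℕ-* m (m ^ j)) (cong (ιℕ m *_) (ιℕ-^ m j))

*-nonneg : ∀ {a b} → 0ℚ ≤ a → 0ℚ ≤ b → 0ℚ ≤ a * b
*-nonneg {a} {b} 0≤a 0≤b =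
  ℚ.nonNegative⁻¹ _ {{ℚ.nonNeg*nonNeg⇒nonNeg a {{nonNegative 0≤a}} b {{nonNegative 0≤b}}}}

*-monoˡ-≤-nonneg : ∀ {r p q} → 0ℚ ≤ r → p ≤ q → r * p ≤ r * q
*-monoˡ-≤-nonneg {r} 0≤r = ℚ.*-monoˡ-≤-nonNeg r {{nonNegative 0≤r}}

*-monoʳ-≤-nonneg : ∀ {r p q} → 0ℚ ≤ r → p ≤ q → p * r ≤ q * r
*-monoʳ-≤-nonneg {r} 0≤r = ℚ.*-monoʳ-≤-nonNeg r {{nonNegative 0≤r}}

^-nonneg : ∀ {a} j → 0ℚ ≤ a → 0ℚ ≤ a ^ℚ j
^-nonneg ℕ.zero    0≤a = ℚ.nonNegative⁻¹ 1ℚ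
^-nonneg (ℕ.suc j) 0≤a = *-nonneg 0≤a (^-nonneg j 0≤a)

^-pos : ∀ {a} j → 0ℚ < a → 0ℚ < a ^ℚ j
^-pos ℕ.zero        0<a = ℚ.positive⁻¹ 1ℚ
^-pos {a} (ℕ.suc j) 0<a =
  ℚ.positive⁻¹ _ {{ℚ.pos*pos⇒pos a {{positive 0<a}} (a ^ℚ j) {{positive (^-pos j 0<a)}}}}

^-mono-≤ : ∀ {a b} j → 0ℚ ≤ a → a ≤ b → a ^ℚ j ≤ b ^ℚ j
^-mono-≤ ℕ.zero    0≤a a≤b = ℚ.≤-refl
^-mono-≤ (ℕ.suc j) 0≤a a≤b = ℚ.≤-trans
  (*-monoʳ-≤-nonneg (^-nonneg j 0≤a) a≤b)
  (*-monoˡ-≤-nonneg (ℚ.≤-trans 0≤a a≤b) (^-mono-≤ j 0≤a a≤b))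

^-distribʳ-* : ∀ a b j → (a * b) ^ℚ j ≡ a ^ℚ j * b ^ℚ j
^-distribʳ-* a b ℕ.zero    = refl
^-distribʳ-* a b (ℕ.suc j) rewrite ^-distribʳ-* a b j =
  solve 4 (λ a b x y → (a :* b) :* (x :* y) := (a :* x) :* (b :* y)) refl a b (a ^ℚ j) (b ^ℚ j)

^-*2 : ∀ a l → a ^ℚ (l ℕ.* 2) ≡ (a ^ℚ 2) ^ℚ l
^-*2 a ℕ.zero    = refl
^-*2 a (ℕ.suc l) rewrite ^-*2 a l =
  solve 2 (λ a x → a :* (a :* x) := (a :* (a :* con 1ℚ)) :* x) refl a ((a ^ℚ 2) ^ℚ l)

^2-nonneg : ∀ a → 0ℚ ≤ a ^ℚ 2
^2-nonneg a with ℚ.≤-total 0ℚ a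
... | inj₁ 0≤a = ^-nonneg 2 0≤a
... | inj₂ a≤0 = ℚ.≤-trans
  (ℚ.nonNegative⁻¹ _ {{ℚ.nonPos*nonPos⇒nonPos a {{nonPositive a≤0}} a {{nonPositive a≤0}}}})
  (ℚ.≤-reflexive (cong (a *_) (sym (ℚ.*-identityʳ a))))

∑ : List A → (A → ℚ) → ℚ
∑ xs f = sumℚ (map f xs)

syntax ∑ xs (λ x → e) = ∑[ x ∈ xs ] e

∑-cong : ∀ (xs : List A) {f g : A → ℚ} → (∀ x → f x ≡ g x) → ∑ xs f ≡ ∑ xs g
∑-cong []       f≡g = refl
∑-cong (x ∷ xs) f≡g = cong₂ _+_ (f≡g x) (∑-cong xs f≡g)

∑-mono-≤ : ∀ (xs : List A) {f g : A → ℚ} → (∀ x → f x ≤ g x) → ∑ xs f ≤ ∑ xs g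
∑-mono-≤ []       f≤g = ℚ.≤-refl
∑-mono-≤ (x ∷ xs) f≤g = ℚ.+-mono-≤ (f≤g x) (∑-mono-≤ xs f≤g)

∑-zero : ∀ (xs : List A) → ∑[ x ∈ xs ] 0ℚ ≡ 0ℚ
∑-zero []       = refl
∑-zero (x ∷ xs) = trans (ℚ.+-identityˡ _) (∑-zero xs)

∑-nonneg : ∀ (xs : List A) {f : A → ℚ} → (∀ x → 0ℚ ≤ f x) → 0ℚ ≤ ∑ xs f
∑-nonneg xs {f} 0≤f = subst (_≤ ∑ xs f) (∑-zero xs) (∑-mono-≤ xs 0≤f)

∑-+ : ∀ (xs : List A) (f g : A → ℚ) → ∑[ x ∈ xs ] (f x + g x) ≡ ∑ xs f + ∑ xs g
∑-+ []       f g = refl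
∑-+ (x ∷ xs) f g rewrite ∑-+ xs f g =
  solve 4 (λ a b c d → (a :+ b) :+ (c :+ d) := (a :+ c) :+ (b :+ d)) refl (f x) (g x) (∑ xs f) (∑ xs g)

∑-*ˡ : ∀ (xs : List A) c (f : A → ℚ) → ∑[ x ∈ xs ] (c * f x) ≡ c * ∑ xs f
∑-*ˡ []       c f = sym (ℚ.*-zeroʳ c)
∑-*ˡ (x ∷ xs) c f rewrite ∑-*ˡ xs c f = sym (ℚ.*-distribˡ-+ c (f x) (∑ xs f))

∑-*ʳ : ∀ (xs : List A) c (f : A → ℚ) → ∑[ x ∈ xs ] (f x * c) ≡ ∑ xs f * c
∑-*ʳ []       c f = sym (ℚ.*-zeroˡ c)
∑-*ʳ (x ∷ xs) c f rewrite ∑-*ʳ xs c f = sym (ℚ.*-distribʳ-+ c (f x) (∑ xs f))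

∑-const : ∀ (xs : List A) c → ∑[ x ∈ xs ] c ≡ ιℕ (List.length xs) * c
∑-const []       c = sym (ℚ.*-zeroˡ c)
∑-const (x ∷ xs) c rewrite ∑-const xs c | ιℕ-suc (List.length xs) =
  solve 2 (λ l c → c :+ l :* c := (con 1ℚ :+ l) :* c) refl (ιℕ (List.length xs)) c

∑-++ : ∀ (xs ys : List A) f → ∑ (xs ++ ys) f ≡ ∑ xs f + ∑ ys f
∑-++ []       ys f = sym (ℚ.+-identityˡ _)
∑-++ (x ∷ xs) ys f rewrite ∑-++ xs ys f = sym (ℚ.+-assoc (f x) (∑ xs f) (∑ ys f))

∑-comm : ∀ (xs : List A) (ys : List B) (f : A → B → ℚ) →
         ∑[ x ∈ xs ] ∑[ y ∈ ys ] f x y ≡ ∑[ y ∈ ys ] ∑[ x ∈ xs ] f x y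
∑-comm []       ys f = sym (∑-zero ys)
∑-comm (x ∷ xs) ys f rewrite ∑-comm xs ys f = sym (∑-+ ys (f x) (λ y → ∑[ x ∈ xs ] f x y))

∑-concatMap : ∀ (xs : List A) (h : A → List B) f → ∑ (concatMap h xs) f ≡ ∑[ x ∈ xs ] ∑ (h x) f
∑-concatMap []       h f = refl
∑-concatMap (x ∷ xs) h f rewrite ∑-++ (h x) (concatMap h xs) f | ∑-concatMap xs h f = refl

∑-map : ∀ (xs : List A) (h : A → B) f → ∑ (map h xs) f ≡ ∑[ x ∈ xs ] f (h x)
∑-map []       h f = refl
∑-map (x ∷ xs) h f rewrite ∑-map xs h f = refl

∑-tuples-suc : ∀ (xs : List A) m (f : Vec A (ℕ.suc m) → ℚ) →
               ∑ (tuples xs (ℕ.suc m)) f ≡ ∑[ x ∈ xs ] ∑[ s ∈ tuples xs m ] f (x ∷ s)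
∑-tuples-suc xs m f = trans (∑-concatMap xs _ f) (∑-cong xs (λ x → ∑-map (tuples xs m) (x ∷_) f))

∑-allFin-suc : ∀ n (f : Fin (ℕ.suc n) → ℚ) → ∑ (allFin (ℕ.suc n)) f ≡ f zero + ∑[ i ∈ allFin n ] f (suc i)
∑-allFin-suc n f = cong (λ fs → f zero + sumℚ fs)
  (trans (List.map-tabulate suc f) (sym (List.map-tabulate (λ i → i) (f ∘ suc))))

∑-allFin-const : ∀ n c → ∑[ i ∈ allFin n ] c ≡ ιℕ n * c
∑-allFin-const n c = trans (∑-const (allFin n) c) (cong (λ l → ιℕ l * c) (List.length-tabulate {n = n} (λ i → i)))

∑-allFin-pick-≤ : ∀ (v : Fin n) {f g : Fin n → ℚ} → (∀ u → 0ℚ ≤ g u) → (∀ u → u ≢ v → f u ≤ g u) →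
                  ∑ (allFin n) f ≤ f v + ∑ (allFin n) g
∑-allFin-pick-≤ {ℕ.suc n} zero {f} {g} 0≤g f≤g = begin
  ∑ (allFin (ℕ.suc n)) f                   ≡⟨ ∑-allFin-suc n f ⟩
  f zero + ∑[ i ∈ allFin n ] f (suc i)     ≤⟨ ℚ.+-monoʳ-≤ (f zero) (∑-mono-≤ (allFin n) (λ i → f≤g (suc i) (λ ()))) ⟩
  f zero + ∑[ i ∈ allFin n ] g (suc i)     ≡⟨ cong (_+_ (f zero)) (sym (ℚ.+-identityˡ _)) ⟩
  f zero + (0ℚ + ∑[ i ∈ allFin n ] g (suc i)) ≤⟨ ℚ.+-monoʳ-≤ (f zero) (ℚ.+-monoˡ-≤ _ (0≤g zero)) ⟩
  f zero + (g zero + ∑[ i ∈ allFin n ] g (suc i)) ≡⟨ cong (_+_ (f zero)) (sym (∑-allFin-suc n g)) ⟩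
  f zero + ∑ (allFin (ℕ.suc n)) g          ∎
  where open ℚ.≤-Reasoning
∑-allFin-pick-≤ {ℕ.suc n} (suc v) {f} {g} 0≤g f≤g = begin
  ∑ (allFin (ℕ.suc n)) f                   ≡⟨ ∑-allFin-suc n f ⟩
  f zero + ∑[ i ∈ allFin n ] f (suc i)     ≤⟨ ℚ.+-mono-≤ (f≤g zero (λ ()))
                                                (∑-allFin-pick-≤ v (0≤g ∘ suc) (λ u u≢v → f≤g (suc u) (u≢v ∘ Fin.suc-injective))) ⟩
  g zero + (f (suc v) + ∑[ i ∈ allFin n ] g (suc i)) ≡⟨ solve 3 (λ a b c → a :+ (b :+ c) := b :+ (a :+ c)) refl
                                                          (g zero) (f (suc v)) (∑[ i ∈ allFin n ] g (suc i)) ⟩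
  f (suc v) + (g zero + ∑[ i ∈ allFin n ] g (suc i)) ≡⟨ cong (_+_ (f (suc v))) (sym (∑-allFin-suc n g)) ⟩
  f (suc v) + ∑ (allFin (ℕ.suc n)) g       ∎
  where open ℚ.≤-Reasoning

multinomial : ∀ (xs : List A) (a : A → ℚ) k → ∑ xs a ^ℚ k ≡ ∑[ I ∈ tuples xs k ] prodℚ (Vec.map a I)
multinomial xs a ℕ.zero    = sym (ℚ.+-identityʳ 1ℚ)
multinomial xs a (ℕ.suc k) = begin
  ∑ xs a * ∑ xs a ^ℚ k                                        ≡⟨ cong (∑ xs a *_) (multinomial xs a k) ⟩
  ∑ xs a * ∑[ I ∈ tuples xs k ] prodℚ (Vec.map a I)            ≡⟨ sym (∑-*ʳ xs _ a) ⟩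
  ∑[ i ∈ xs ] (a i * ∑[ I ∈ tuples xs k ] prodℚ (Vec.map a I)) ≡⟨ ∑-cong xs (λ i → sym (∑-*ˡ (tuples xs k) (a i) _)) ⟩
  ∑[ i ∈ xs ] ∑[ I ∈ tuples xs k ] (a i * prodℚ (Vec.map a I)) ≡⟨ sym (∑-tuples-suc xs k _) ⟩
  ∑[ I ∈ tuples xs (ℕ.suc k) ] prodℚ (Vec.map a I)             ∎
  where open ≡-Reasoning

1^ℚ : ∀ m → 1ℚ ^ℚ m ≡ 1ℚ
1^ℚ ℕ.zero    = refl
1^ℚ (ℕ.suc m) = trans (ℚ.*-identityˡ _) (1^ℚ m)

record Dist (A : Set) : Set where
  field
    support     : List A
    mass        : A → ℚ
    mass-nonneg : ∀ x → 0ℚ ≤ mass x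
    mass-total  : ∑ support mass ≡ 1ℚ

open Dist

𝔼 : Dist A → (A → ℚ) → ℚ
𝔼 D f = ∑[ x ∈ support D ] (mass D x * f x)

module _ (D : Dist A) where

  𝔼-cong : ∀ {f g : A → ℚ} → (∀ x → f x ≡ g x) → 𝔼 D f ≡ 𝔼 D g
  𝔼-cong f≡g = ∑-cong (support D) (λ x → cong (mass D x *_) (f≡g x))

  𝔼-mono-≤ : ∀ {f g : A → ℚ} → (∀ x → f x ≤ g x) → 𝔼 D f ≤ 𝔼 D g
  𝔼-mono-≤ f≤g = ∑-mono-≤ (support D) (λ x → *-monoˡ-≤-nonneg (mass-nonneg D x) (f≤g x))

  𝔼-+ : ∀ f g → 𝔼 D (λ x → f x + g x) ≡ 𝔼 D f + 𝔼 D g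
  𝔼-+ f g = trans (∑-cong (support D) (λ x → ℚ.*-distribˡ-+ (mass D x) (f x) (g x))) (∑-+ (support D) _ _)

  𝔼-*ˡ : ∀ c f → 𝔼 D (λ x → c * f x) ≡ c * 𝔼 D f
  𝔼-*ˡ c f = trans
    (∑-cong (support D) (λ x → solve 3 (λ p c y → p :* (c :* y) := c :* (p :* y)) refl (mass D x) c (f x)))
    (∑-*ˡ (support D) c _)

  𝔼-*ʳ : ∀ c f → 𝔼 D (λ x → f x * c) ≡ 𝔼 D f * c
  𝔼-*ʳ c f = trans (∑-cong (support D) (λ x → sym (ℚ.*-assoc (mass D x) (f x) c))) (∑-*ʳ (support D) c _)

  𝔼-const : ∀ c → 𝔼 D (λ _ → c) ≡ c
  𝔼-const c = trans (∑-*ʳ (support D) c (mass D)) (trans (cong (_* c) (mass-total D)) (ℚ.*-identityˡ c))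

  𝔼-nonneg : ∀ {f} → (∀ x → 0ℚ ≤ f x) → 0ℚ ≤ 𝔼 D f
  𝔼-nonneg {f} 0≤f = subst (_≤ 𝔼 D f) (𝔼-const 0ℚ) (𝔼-mono-≤ 0≤f)

  𝔼-∑ : ∀ (ys : List B) (f : A → B → ℚ) → 𝔼 D (λ x → ∑[ y ∈ ys ] f x y) ≡ ∑[ y ∈ ys ] 𝔼 D (λ x → f x y)
  𝔼-∑ ys f = trans (∑-cong (support D) (λ x → sym (∑-*ˡ ys (mass D x) (f x)))) (∑-comm (support D) ys _)

_^ᴰ_ : Dist A → (m : ℕ) → Dist (Vec A m)
support     (D ^ᴰ m)   = tuples (support D) m
mass        (D ^ᴰ m) s = prodℚ (Vec.map (mass D) s)
mass-nonneg (D ^ᴰ m)   = prodℚ-nonneg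
  where
  prodℚ-nonneg : ∀ {m} (s : Vec _ m) → 0ℚ ≤ prodℚ (Vec.map (mass D) s)
  prodℚ-nonneg []      = ℚ.nonNegative⁻¹ 1ℚ
  prodℚ-nonneg (x ∷ s) = *-nonneg (mass-nonneg D x) (prodℚ-nonneg s)
mass-total  (D ^ᴰ m)   = begin
  ∑[ s ∈ tuples (support D) m ] prodℚ (Vec.map (mass D) s) ≡⟨ sym (multinomial (support D) (mass D) m) ⟩
  ∑ (support D) (mass D) ^ℚ m                                ≡⟨ cong (_^ℚ m) (mass-total D) ⟩
  1ℚ ^ℚ m                                                    ≡⟨ 1^ℚ m ⟩
  1ℚ                                                         ∎
  where open ≡-Reasoning

module _ (D : Dist A) where

  𝔼-^ᴰ-suc : ∀ m (f : Vec A (ℕ.suc m) → ℚ) → 𝔼 (D ^ᴰ ℕ.suc m) f ≡ 𝔼 D (λ x → 𝔼 (D ^ᴰ m) (λ s → f (x ∷ s)))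
  𝔼-^ᴰ-suc m f = trans (∑-tuples-suc (support D) m _) (∑-cong (support D) (λ x → trans
    (∑-cong (support (D ^ᴰ m)) (λ s → ℚ.*-assoc (mass D x) (mass (D ^ᴰ m) s) (f (x ∷ s))))
    (∑-*ˡ (support (D ^ᴰ m)) (mass D x) _)))

  𝔼-lookup : ∀ {m} (j : Fin m) (h : A → ℚ) → 𝔼 (D ^ᴰ m) (λ s → h (lookup s j)) ≡ 𝔼 D h
  𝔼-lookup {ℕ.suc m} zero    h = trans (𝔼-^ᴰ-suc m _) (𝔼-cong D (λ x → 𝔼-const (D ^ᴰ m) (h x)))
  𝔼-lookup {ℕ.suc m} (suc j) h = trans (𝔼-^ᴰ-suc m _) (trans (𝔼-cong D (λ _ → 𝔼-lookup j h)) (𝔼-const D _))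

  𝔼-lookup-pair : ∀ {m} {i j : Fin m} (h : A → A → ℚ) → i Fin.< j →
                  𝔼 (D ^ᴰ m) (λ s → h (lookup s i) (lookup s j)) ≡ 𝔼 D (λ x → 𝔼 D (h x))
  𝔼-lookup-pair {ℕ.suc m} {zero}  {suc j} h _ = trans (𝔼-^ᴰ-suc m _) (𝔼-cong D (λ x → 𝔼-lookup j (h x)))
  𝔼-lookup-pair {ℕ.suc m} {suc i} {suc j} h (ℕ.s≤s i<j) =
    trans (𝔼-^ᴰ-suc m _) (trans (𝔼-cong D (λ _ → 𝔼-lookup-pair h i<j)) (𝔼-const D _))

inv2^-nonneg : ∀ n → 0ℚ ≤ inv2^ n
inv2^-nonneg ℕ.zero    = ℚ.nonNegative⁻¹ 1ℚ
inv2^-nonneg (ℕ.suc n) = *-nonneg (ℚ.nonNegative⁻¹ ((+ 1) /ℚ 2)) (inv2^-nonneg n)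

cubeDist : ∀ {φ} → IsDensity n φ → Dist (Cube n)
support     (cubeDist {n} dens)           = allCube n
mass        (cubeDist {n} {φ} dens) x     = φ x * inv2^ n
mass-nonneg (cubeDist {n} dens) x         = *-nonneg (IsDensity.nonneg dens x) (inv2^-nonneg n)
mass-total  (cubeDist {n} {φ} dens)       = trans (∑-*ʳ (allCube n) (inv2^ n) φ) (IsDensity.normalised dens)

𝔼-cubeDist : ∀ {φ} (dens : IsDensity n φ) f → 𝔼 (cubeDist dens) f ≡ E n (λ x → φ x * f x)
𝔼-cubeDist {n} {φ} dens f = trans
  (∑-cong (allCube n) (λ x → solve 3 (λ a c d → (a :* c) :* d := (a :* d) :* c) refl (φ x) (inv2^ n) (f x)))
  (∑-*ʳ (allCube n) (inv2^ n) _)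

-- The union bound over pairs of samples

ind : Bool → ℚ
ind b = if b then 1ℚ else 0ℚ

ind-nonneg : ∀ b → 0ℚ ≤ ind b
ind-nonneg true  = ℚ.nonNegative⁻¹ 1ℚ
ind-nonneg false = ℚ.≤-refl

ind-+-not : ∀ b → ind b + ind (not b) ≡ 1ℚ
ind-+-not true  = refl
ind-+-not false = refl

if-then-0 : ∀ b a → (if b then a else 0ℚ) ≡ a * ind b
if-then-0 true  a = sym (ℚ.*-identityʳ a)
if-then-0 false a = sym (ℚ.*-zeroʳ a)

ind-not-and : ∀ (xs : List A) (h : A → Bool) → ind (not (and (map h xs))) ≤ ∑[ x ∈ xs ] ind (not (h x))
ind-not-and []       h = ℚ.≤-refl
ind-not-and (x ∷ xs) h with h x
... | true  = ℚ.≤-trans (ind-not-and xs h) (ℚ.≤-reflexive (sym (ℚ.+-identityˡ _)))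
... | false = ℚ.≤-trans (ℚ.≤-reflexive (sym (ℚ.+-identityʳ 1ℚ)))
                        (ℚ.+-monoʳ-≤ 1ℚ (∑-nonneg xs (λ y → ind-nonneg (not (h y)))))

pairProb : Dist A → (A → A → Bool) → ℚ
pairProb D g = 𝔼 D (λ x → 𝔼 D (λ y → ind (g x y)))

pairProb-nonneg : ∀ (D : Dist A) g → 0ℚ ≤ pairProb D g
pairProb-nonneg D g = 𝔼-nonneg D (λ x → 𝔼-nonneg D (λ y → ind-nonneg (g x y)))

-- accepts n t unfolds to noPair (far n t).
noPair : (A → A → Bool) → Vec A m → Bool
noPair {m = m} g s =
  and (map (λ i → and (map (λ j → not (⌊ i <? j ⌋ ∧ g (lookup s i) (lookup s j))) (allFin m))) (allFin m))

ind-not-noPair : ∀ (g : A → A → Bool) (s : Vec A m) →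
  ind (not (noPair g s)) ≤ ∑[ i ∈ allFin m ] ∑[ j ∈ allFin m ] ind (⌊ i <? j ⌋ ∧ g (lookup s i) (lookup s j))
ind-not-noPair {m = m} g s = ℚ.≤-trans (ind-not-and (allFin m) _) (∑-mono-≤ (allFin m) (λ i →
  ℚ.≤-trans (ind-not-and (allFin m) _)
            (ℚ.≤-reflexive (∑-cong (allFin m) (λ j → cong ind (Bool.not-involutive _))))))

module _ (D : Dist A) (g : A → A → Bool) where

  𝔼-orderedPair-≤ : ∀ (i j : Fin m) →
    𝔼 (D ^ᴰ m) (λ s → ind (⌊ i <? j ⌋ ∧ g (lookup s i) (lookup s j))) ≤ pairProb D g
  𝔼-orderedPair-≤ {m} i j with i <? j
  ... | yes i<j = ℚ.≤-reflexive (𝔼-lookup-pair D (λ x y → ind (g x y)) i<j)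
  ... | no _    = subst (_≤ pairProb D g) (sym (𝔼-const (D ^ᴰ m) 0ℚ)) (pairProb-nonneg D g)

  noPair-prob : ∀ m → 1ℚ ≤ 𝔼 (D ^ᴰ m) (λ s → ind (noPair g s)) + ιℕ m * (ιℕ m * pairProb D g)
  noPair-prob m = begin
    1ℚ                                                        ≡⟨ sym (𝔼-const Dᵐ 1ℚ) ⟩
    𝔼 Dᵐ (λ _ → 1ℚ)                                           ≡⟨ sym (𝔼-cong Dᵐ (λ s → ind-+-not (noPair g s))) ⟩
    𝔼 Dᵐ (λ s → ind (noPair g s) + ind (not (noPair g s)))    ≡⟨ 𝔼-+ Dᵐ _ _ ⟩
    P + 𝔼 Dᵐ (λ s → ind (not (noPair g s)))                   ≤⟨ ℚ.+-monoʳ-≤ P (𝔼-mono-≤ Dᵐ (ind-not-noPair g)) ⟩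
    P + 𝔼 Dᵐ (λ s → ∑[ i ∈ F ] ∑[ j ∈ F ] bad i j s)           ≡⟨ cong (_+_ P) (trans (𝔼-∑ Dᵐ F _)
                                                                    (∑-cong F (λ i → 𝔼-∑ Dᵐ F _))) ⟩
    P + ∑[ i ∈ F ] ∑[ j ∈ F ] 𝔼 Dᵐ (bad i j)                   ≤⟨ ℚ.+-monoʳ-≤ P (∑-mono-≤ F (λ i →
                                                                    ∑-mono-≤ F (𝔼-orderedPair-≤ i))) ⟩
    P + ∑[ i ∈ F ] ∑[ j ∈ F ] pairProb D g                     ≡⟨ cong (_+_ P) (trans (∑-cong F (λ i →
                                                                    ∑-allFin-const m _)) (∑-allFin-const m _)) ⟩
    P + ιℕ m * (ιℕ m * pairProb D g)                           ∎
    where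
    open ℚ.≤-Reasoning
    Dᵐ = D ^ᴰ m
    F = allFin m
    P = 𝔼 Dᵐ (λ s → ind (noPair g s))
    bad : Fin m → Fin m → Vec A m → ℚ
    bad i j s = ind (⌊ i <? j ⌋ ∧ g (lookup s i) (lookup s j))

acceptProb≡𝔼 : ∀ {φ} (dens : IsDensity n φ) m t → acceptProb n φ m t ≡ 𝔼 (cubeDist dens ^ᴰ m) (λ s → ind (accepts n t s))
acceptProb≡𝔼 {n} dens m t = ∑-cong (tuples (allCube n) m) (λ s → if-then-0 (accepts n t s) _)

-- Parity sets of index tuples

toggle : Fin n → Subset n → Subset n
toggle zero    (b ∷ S) = not b ∷ S
toggle (suc i) (b ∷ S) = b ∷ toggle i S

parity : ∀ {k} → Vec (Fin n) k → Subset n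
parity []      = ⊥
parity (i ∷ I) = toggle i (parity I)

toggle-involutive : ∀ (i : Fin n) S → toggle i (toggle i S) ≡ S
toggle-involutive zero    (b ∷ S) = cong (_∷ S) (Bool.not-involutive b)
toggle-involutive (suc i) (b ∷ S) = cong (b ∷_) (toggle-involutive i S)

toggle-comm : ∀ (i j : Fin n) S → toggle i (toggle j S) ≡ toggle j (toggle i S)
toggle-comm zero    zero    (b ∷ S) = refl
toggle-comm zero    (suc j) (b ∷ S) = refl
toggle-comm (suc i) zero    (b ∷ S) = refl
toggle-comm (suc i) (suc j) (b ∷ S) = cong (b ∷_) (toggle-comm i j S)

x∈toggle-x-⊥ : ∀ (x : Fin n) → x ∈ toggle x ⊥
x∈toggle-x-⊥ zero    = here
x∈toggle-x-⊥ (suc x) = there (x∈toggle-x-⊥ x)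

∈-toggle-≢ : ∀ {u v : Fin n} {S} → u ≢ v → v ∈ S → v ∈ toggle u S
∈-toggle-≢ {u = zero}  {zero}  u≢v _          = ⊥-elim (u≢v refl)
∈-toggle-≢ {u = zero}  {suc v} u≢v (there v∈S) = there v∈S
∈-toggle-≢ {u = suc u} {zero}  u≢v here        = here
∈-toggle-≢ {u = suc u} {suc v} u≢v (there v∈S) = there (∈-toggle-≢ (u≢v ∘ cong suc) v∈S)

∣toggle∣≤ : ∀ (i : Fin n) S → ∣ toggle i S ∣ ℕ.≤ ℕ.suc ∣ S ∣
∣toggle∣≤ zero    (true  ∷ S) = ℕ.m≤n⇒m≤1+n (ℕ.n≤1+n _)
∣toggle∣≤ zero    (false ∷ S) = ℕ.≤-refl
∣toggle∣≤ (suc i) (true  ∷ S) = ℕ.s≤s (∣toggle∣≤ i S)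
∣toggle∣≤ (suc i) (false ∷ S) = ∣toggle∣≤ i S

∣parity∣≤ : ∀ {k} (I : Vec (Fin n) k) → ∣ parity I ∣ ℕ.≤ k
∣parity∣≤ {n} []      = ℕ.≤-reflexive (Subset.∣⊥∣≡0 n)
∣parity∣≤     (i ∷ I) = ℕ.≤-trans (∣toggle∣≤ i (parity I)) (ℕ.s≤s (∣parity∣≤ I))

∣S∣≡0⇒S≡⊥ : ∀ (S : Subset n) → ∣ S ∣ ≡ 0 → S ≡ ⊥
∣S∣≡0⇒S≡⊥ []          _     = refl
∣S∣≡0⇒S≡⊥ (true  ∷ S) ()
∣S∣≡0⇒S≡⊥ (false ∷ S) ∣S∣≡0 = cong (false ∷_) (∣S∣≡0⇒S≡⊥ S ∣S∣≡0)

_≟ₛ_ : (S T : Subset n) → Dec (S ≡ T)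
_≟ₛ_ = Vec.≡-dec Bool._≟_

δ : Subset n → Subset n → ℚ
δ S T = ind (does (S ≟ₛ T))

δ-toggle : ∀ (u : Fin n) S T → δ (toggle u S) T ≡ δ S (toggle u T)
δ-toggle u S T with S ≟ₛ toggle u T
... | yes S≡uT = cong ind (dec-true (toggle u S ≟ₛ T) (trans (cong (toggle u) S≡uT) (toggle-involutive u T)))
... | no  S≢uT = cong ind (dec-false (toggle u S ≟ₛ T)
                   (λ uS≡T → S≢uT (trans (sym (toggle-involutive u S)) (cong (toggle u) uS≡T))))

parityCount : ℕ → Subset n → ℚ
parityCount {n} k T = ∑[ I ∈ tuples (allFin n) k ] δ (parity I) T

parityCount-suc : ∀ k (T : Subset n) → parityCount (ℕ.suc k) T ≡ ∑[ u ∈ allFin n ] parityCount k (toggle u T)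
parityCount-suc {n} k T = trans (∑-tuples-suc (allFin n) k _)
  (∑-cong (allFin n) (λ u → ∑-cong (tuples (allFin n) k) (λ I → δ-toggle u (parity I) T)))

parityCount-zero-⊥ : parityCount 0 (⊥ {n}) ≡ 1ℚ
parityCount-zero-⊥ {n} = cong (λ b → ind b + 0ℚ) (dec-true (⊥ {n} ≟ₛ ⊥) refl)

parityCount-zero-∈ : ∀ {T : Subset n} {v} → v ∈ T → parityCount 0 T ≡ 0ℚ
parityCount-zero-∈ {T = T} {v} v∈T =
  cong (λ b → ind b + 0ℚ) (dec-false (⊥ ≟ₛ T) (λ ⊥≡T → Subset.∉⊥ (subst (v ∈_) (sym ⊥≡T) v∈T)))

parityCount-nonneg : ∀ k (T : Subset n) → 0ℚ ≤ parityCount k T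
parityCount-nonneg {n} k T = ∑-nonneg (tuples (allFin n) k) (λ I → ind-nonneg (does (parity I ≟ₛ T)))

-- The first index u of a tuple is either v, or it leaves v in toggle u T and induction applies.
parityCount-suc-≤ : ∀ k {T : Subset n} {v} → v ∈ T →
                    parityCount (ℕ.suc k) T ≤ ιℕ (ℕ.suc k) * parityCount k (toggle v T)
parityCount-suc-≤ {n} ℕ.zero {T} {v} v∈T = begin
  parityCount 1 T                                ≡⟨ parityCount-suc 0 T ⟩
  ∑[ u ∈ allFin n ] parityCount 0 (toggle u T)   ≤⟨ ∑-allFin-pick-≤ v (λ _ → ℚ.≤-refl) (λ u u≢v →
                                                      ℚ.≤-reflexive (parityCount-zero-∈ (∈-toggle-≢ u≢v v∈T))) ⟩
  C + ∑[ u ∈ allFin n ] 0ℚ                       ≡⟨ trans (cong (_+_ C) (∑-zero (allFin n))) (ℚ.+-identityʳ C) ⟩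
  C                                              ≡⟨ sym (ℚ.*-identityˡ C) ⟩
  ιℕ 1 * C                                       ∎
  where
  open ℚ.≤-Reasoning
  C = parityCount 0 (toggle v T)
parityCount-suc-≤ {n} (ℕ.suc k) {T} {v} v∈T = begin
  parityCount (ℕ.suc (ℕ.suc k)) T                 ≡⟨ parityCount-suc (ℕ.suc k) T ⟩
  ∑[ u ∈ allFin n ] parityCount (ℕ.suc k) (toggle u T)
    ≤⟨ ∑-allFin-pick-≤ v (λ u → *-nonneg (ιℕ-nonneg (ℕ.suc k)) (parityCount-nonneg k _)) off-v ⟩
  C + ∑[ u ∈ allFin n ] (ιℕ (ℕ.suc k) * parityCount k (toggle u (toggle v T)))
    ≡⟨ cong (_+_ C) (trans (∑-*ˡ (allFin n) (ιℕ (ℕ.suc k)) _) (cong (ιℕ (ℕ.suc k) *_) (sym (parityCount-suc {n} k (toggle v T))))) ⟩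
  C + ιℕ (ℕ.suc k) * C                            ≡⟨ solve 2 (λ a c → c :+ a :* c := (con 1ℚ :+ a) :* c) refl (ιℕ (ℕ.suc k)) C ⟩
  (1ℚ + ιℕ (ℕ.suc k)) * C                         ≡⟨ cong (_* C) (sym (ιℕ-suc (ℕ.suc k))) ⟩
  ιℕ (ℕ.suc (ℕ.suc k)) * C                        ∎
  where
  open ℚ.≤-Reasoning
  C = parityCount (ℕ.suc k) (toggle v T)
  off-v : ∀ u → u ≢ v → parityCount (ℕ.suc k) (toggle u T) ≤ ιℕ (ℕ.suc k) * parityCount k (toggle u (toggle v T))
  off-v u u≢v = subst (λ S → _ ≤ ιℕ (ℕ.suc k) * parityCount k S) (toggle-comm v u T)
                      (parityCount-suc-≤ {n} k (∈-toggle-≢ u≢v v∈T))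

parityCount-⊥-suc-suc : ∀ k → parityCount (ℕ.suc (ℕ.suc k)) (⊥ {n}) ≤ ιℕ n * (ιℕ (ℕ.suc k) * parityCount k ⊥)
parityCount-⊥-suc-suc {n} k = begin
  parityCount (ℕ.suc (ℕ.suc k)) (⊥ {n})                    ≡⟨ parityCount-suc {n} (ℕ.suc k) ⊥ ⟩
  ∑[ u ∈ allFin n ] parityCount (ℕ.suc k) (toggle u ⊥)      ≤⟨ ∑-mono-≤ (allFin n) (λ u →
                                                                 parityCount-suc-≤ {n} k (x∈toggle-x-⊥ u)) ⟩
  ∑[ u ∈ allFin n ] (ιℕ (ℕ.suc k) * parityCount k (toggle u (toggle u ⊥)))
    ≡⟨ ∑-cong (allFin n) (λ u → cong (λ S → ιℕ (ℕ.suc k) * parityCount k S) (toggle-involutive u ⊥)) ⟩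
  ∑[ u ∈ allFin n ] (ιℕ (ℕ.suc k) * parityCount k ⊥)        ≡⟨ ∑-allFin-const n _ ⟩
  ιℕ n * (ιℕ (ℕ.suc k) * parityCount k ⊥)                   ∎
  where open ℚ.≤-Reasoning

-- (2l - 1)!!, the number of perfect matchings of 2l points
matchings : ℕ → ℕ
matchings ℕ.zero    = 1
matchings (ℕ.suc l) = ℕ.suc (l *ℕ 2) *ℕ matchings l

parityCount-⊥-≤ : ∀ l → parityCount (l *ℕ 2) (⊥ {n}) ≤ ιℕ (matchings l) * ιℕ n ^ℚ l
parityCount-⊥-≤ {n} ℕ.zero = ℚ.≤-reflexive (parityCount-zero-⊥ {n})
parityCount-⊥-≤ {n} (ℕ.suc l) = begin
  parityCount (ℕ.suc (ℕ.suc (l *ℕ 2))) ⊥′                  ≤⟨ parityCount-⊥-suc-suc {n} (l *ℕ 2) ⟩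
  N * (a * parityCount (l *ℕ 2) ⊥′)                        ≤⟨ *-monoˡ-≤-nonneg (ιℕ-nonneg n)
                                                                 (*-monoˡ-≤-nonneg (ιℕ-nonneg (ℕ.suc (l *ℕ 2))) (parityCount-⊥-≤ {n} l)) ⟩
  N * (a * (ιℕ (matchings l) * N ^ℚ l))                     ≡⟨ solve 4 (λ N a b c → N :* (a :* (b :* c)) := (a :* b) :* (N :* c))
                                                                 refl N a (ιℕ (matchings l)) (N ^ℚ l) ⟩
  (a * ιℕ (matchings l)) * N ^ℚ ℕ.suc l                     ≡⟨ cong (_* N ^ℚ ℕ.suc l) (sym (ιℕ-* (ℕ.suc (l *ℕ 2)) (matchings l))) ⟩
  ιℕ (matchings (ℕ.suc l)) * N ^ℚ ℕ.suc l                   ∎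
  where
  open ℚ.≤-Reasoning
  N = ιℕ n
  a = ιℕ (ℕ.suc (l *ℕ 2))
  ⊥′ = ⊥ {n}

2*matchings≤ : ∀ l → 2 *ℕ matchings (ℕ.suc l) ℕ.≤ (ℕ.suc l *ℕ 2) ^ ℕ.suc l
2*matchings≤ ℕ.zero    = ℕ.≤-refl
2*matchings≤ (ℕ.suc l) = begin
  2 *ℕ (ℕ.suc K *ℕ M)        ≡⟨ ℕ*.x∙yz≈y∙xz 2 (ℕ.suc K) M ⟩
  ℕ.suc K *ℕ (2 *ℕ M)        ≤⟨ ℕ.*-monoʳ-≤ (ℕ.suc K) (2*matchings≤ l) ⟩
  ℕ.suc K *ℕ K ^ ℕ.suc l     ≤⟨ ℕ.*-mono-≤ (ℕ.n≤1+n (ℕ.suc K)) (ℕ.^-monoˡ-≤ (ℕ.suc l) (ℕ.m≤n⇒m≤1+n (ℕ.n≤1+n K))) ⟩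
  K′ *ℕ K′ ^ ℕ.suc l         ∎
  where
  open ℕ.≤-Reasoning
  K = ℕ.suc l *ℕ 2
  K′ = ℕ.suc (ℕ.suc l) *ℕ 2
  M = matchings (ℕ.suc l)

-- Moments of the inner product

χ-⊥ : ∀ (x : Cube n) → χ ⊥ x ≡ + 1
χ-⊥ []      = refl
χ-⊥ (b ∷ x) = χ-⊥ x

sgn-sq : ∀ b → sgn b ℤ.* sgn b ≡ + 1
sgn-sq true  = refl
sgn-sq false = refl

χ-toggle : ∀ (i : Fin n) S x → χ (toggle i S) x ≡ sgn (lookup x i) ℤ.* χ S x
χ-toggle zero    (true  ∷ S) (b ∷ x) = sym (begin
  sgn b ℤ.* (sgn b ℤ.* χ S x)  ≡⟨ sym (ℤ.*-assoc (sgn b) (sgn b) (χ S x)) ⟩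
  (sgn b ℤ.* sgn b) ℤ.* χ S x  ≡⟨ cong (ℤ._* χ S x) (sgn-sq b) ⟩
  + 1 ℤ.* χ S x                ≡⟨ ℤ.*-identityˡ (χ S x) ⟩
  χ S x                        ∎)
  where open ≡-Reasoning
χ-toggle zero    (false ∷ S) (b ∷ x) = refl
χ-toggle (suc i) (true  ∷ S) (b ∷ x) = begin
  sgn b ℤ.* χ (toggle i S) x                   ≡⟨ cong (sgn b ℤ.*_) (χ-toggle i S x) ⟩
  sgn b ℤ.* (sgn (lookup x i) ℤ.* χ S x)       ≡⟨ sym (ℤ.*-assoc (sgn b) _ (χ S x)) ⟩
  (sgn b ℤ.* sgn (lookup x i)) ℤ.* χ S x       ≡⟨ cong (ℤ._* χ S x) (ℤ.*-comm (sgn b) _) ⟩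
  (sgn (lookup x i) ℤ.* sgn b) ℤ.* χ S x       ≡⟨ ℤ.*-assoc (sgn (lookup x i)) (sgn b) (χ S x) ⟩
  sgn (lookup x i) ℤ.* (sgn b ℤ.* χ S x)       ∎
  where open ≡-Reasoning
χ-toggle (suc i) (false ∷ S) (b ∷ x) = χ-toggle i S x

χℚ : Subset n → Cube n → ℚ
χℚ S x = ι (χ S x)

coord : Cube n → Fin n → ℚ
coord x i = ι (sgn (lookup x i))

χℚ-parity : ∀ {k} (I : Vec (Fin n) k) x → χℚ (parity I) x ≡ prodℚ (Vec.map (coord x) I)
χℚ-parity []      x = cong ι (χ-⊥ x)
χℚ-parity (i ∷ I) x = begin
  ι (χ (toggle i (parity I)) x)               ≡⟨ cong ι (χ-toggle i (parity I) x) ⟩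
  ι (sgn (lookup x i) ℤ.* χ (parity I) x)     ≡⟨ ι-* (sgn (lookup x i)) (χ (parity I) x) ⟩
  coord x i * χℚ (parity I) x                 ≡⟨ cong (coord x i *_) (χℚ-parity I x) ⟩
  coord x i * prodℚ (Vec.map (coord x) I)     ∎
  where open ≡-Reasoning

prodℚ-map-* : ∀ {k} (f g : A → ℚ) (I : Vec A k) →
              prodℚ (Vec.map (λ i → f i * g i) I) ≡ prodℚ (Vec.map f I) * prodℚ (Vec.map g I)
prodℚ-map-* f g []      = refl
prodℚ-map-* f g (i ∷ I) rewrite prodℚ-map-* f g I =
  solve 4 (λ a b x y → (a :* b) :* (x :* y) := (a :* x) :* (b :* y)) refl
    (f i) (g i) (prodℚ (Vec.map f I)) (prodℚ (Vec.map g I))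

ι-inner : ∀ (x y : Cube n) → ι (inner x y) ≡ ∑[ i ∈ allFin n ] (coord x i * coord y i)
ι-inner           []      []      = refl
ι-inner {ℕ.suc n} (a ∷ x) (b ∷ y) = begin
  ι (sgn a ℤ.* sgn b ℤ.+ inner x y)                              ≡⟨ ι-+ (sgn a ℤ.* sgn b) (inner x y) ⟩
  ι (sgn a ℤ.* sgn b) + ι (inner x y)                            ≡⟨ cong₂ _+_ (ι-* (sgn a) (sgn b)) (ι-inner x y) ⟩
  ι (sgn a) * ι (sgn b) + ∑[ i ∈ allFin n ] (coord x i * coord y i) ≡⟨ sym (∑-allFin-suc n (λ i → coord (a ∷ x) i * coord (b ∷ y) i)) ⟩
  ∑[ i ∈ allFin (ℕ.suc n) ] (coord (a ∷ x) i * coord (b ∷ y) i)   ∎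
  where open ≡-Reasoning

ι-inner-^ : ∀ (x y : Cube n) k →
            ι (inner x y) ^ℚ k ≡ ∑[ I ∈ tuples (allFin n) k ] (χℚ (parity I) x * χℚ (parity I) y)
ι-inner-^ {n} x y k = begin
  ι (inner x y) ^ℚ k                                                         ≡⟨ cong (_^ℚ k) (ι-inner x y) ⟩
  (∑[ i ∈ allFin n ] (coord x i * coord y i)) ^ℚ k                           ≡⟨ multinomial (allFin n) _ k ⟩
  ∑[ I ∈ tuples (allFin n) k ] prodℚ (Vec.map (λ i → coord x i * coord y i) I)
    ≡⟨ ∑-cong (tuples (allFin n) k) (λ I → trans (prodℚ-map-* (coord x) (coord y) I)
                                                   (sym (cong₂ _*_ (χℚ-parity I x) (χℚ-parity I y)))) ⟩
  ∑[ I ∈ tuples (allFin n) k ] (χℚ (parity I) x * χℚ (parity I) y)           ∎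
  where open ≡-Reasoning

𝔼-inner-^ : ∀ (D : Dist (Cube n)) k →
  𝔼 D (λ x → 𝔼 D (λ y → ι (inner x y) ^ℚ k)) ≡ ∑[ I ∈ tuples (allFin n) k ] (𝔼 D (χℚ (parity I)) * 𝔼 D (χℚ (parity I)))
𝔼-inner-^ {n} D k = begin
  𝔼 D (λ x → 𝔼 D (λ y → ι (inner x y) ^ℚ k))               ≡⟨ 𝔼-cong D (λ x → 𝔼-cong D (λ y → ι-inner-^ x y k)) ⟩
  𝔼 D (λ x → 𝔼 D (λ y → ∑[ I ∈ Is ] (χ′ I x * χ′ I y)))    ≡⟨ 𝔼-cong D (λ x → 𝔼-∑ D Is _) ⟩
  𝔼 D (λ x → ∑[ I ∈ Is ] 𝔼 D (λ y → χ′ I x * χ′ I y))      ≡⟨ 𝔼-cong D (λ x → ∑-cong Is (λ I → 𝔼-*ˡ D (χ′ I x) (χ′ I))) ⟩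
  𝔼 D (λ x → ∑[ I ∈ Is ] (χ′ I x * 𝔼 D (χ′ I)))            ≡⟨ 𝔼-∑ D Is _ ⟩
  ∑[ I ∈ Is ] 𝔼 D (λ x → χ′ I x * 𝔼 D (χ′ I))              ≡⟨ ∑-cong Is (λ I → 𝔼-*ʳ D (𝔼 D (χ′ I)) (χ′ I)) ⟩
  ∑[ I ∈ Is ] (𝔼 D (χ′ I) * 𝔼 D (χ′ I))                    ∎
  where
  open ≡-Reasoning
  Is = tuples (allFin n) k
  χ′ : Vec (Fin n) k → Cube n → ℚ
  χ′ I = χℚ (parity I)

𝔼-χ-uniform : ∀ {k φ} (dens : IsDensity n φ) → KWiseUniform n k φ →
              ∀ S → ∣ S ∣ ℕ.≤ k → 𝔼 (cubeDist dens) (χℚ S) ≡ δ S ⊥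
𝔼-χ-uniform dens uniform S ∣S∣≤k with S ≟ₛ ⊥
... | yes refl = trans (𝔼-cong (cubeDist dens) (λ x → cong ι (χ-⊥ x))) (𝔼-const (cubeDist dens) 1ℚ)
... | no  S≢⊥  = trans (𝔼-cubeDist dens (χℚ S))
                       (uniform S (ℕ.n≢0⇒n>0 (S≢⊥ ∘ ∣S∣≡0⇒S≡⊥ S)) ∣S∣≤k)

ind-idem : ∀ b → ind b * ind b ≡ ind b
ind-idem true  = refl
ind-idem false = refl

𝔼-inner-^-uniform : ∀ {k φ} (dens : IsDensity n φ) → KWiseUniform n k φ →
  𝔼 (cubeDist dens) (λ x → 𝔼 (cubeDist dens) (λ y → ι (inner x y) ^ℚ k)) ≡ parityCount k ⊥
𝔼-inner-^-uniform {n} {k} dens uniform = trans (𝔼-inner-^ (cubeDist dens) k)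
  (∑-cong (tuples (allFin n) k) (λ I → trans
    (cong₂ _*_ (𝔼-χ-uniform dens uniform (parity I) (∣parity∣≤ I)) (𝔼-χ-uniform dens uniform (parity I) (∣parity∣≤ I)))
    (ind-idem _)))

-- Markov's inequality for far pairs

markov-≤ᵇ : ∀ {r b} l → 0ℚ ≤ r → 0ℚ ≤ b → ind (not (r ≤ᵇ b)) * b ^ℚ l ≤ r ^ℚ l
markov-≤ᵇ {r} {b} l 0≤r 0≤b with r ≤ᵇ b in r≤ᵇb
... | true  = ℚ.≤-trans (ℚ.≤-reflexive (ℚ.*-zeroˡ (b ^ℚ l))) (^-nonneg l 0≤r)
... | false = ℚ.≤-trans (ℚ.≤-reflexive (ℚ.*-identityˡ (b ^ℚ l)))
                        (^-mono-≤ l 0≤b (ℚ.<⇒≤ (ℚ.≰⇒> (λ r≤b → subst T r≤ᵇb (ℚ.≤⇒≤ᵇ r≤b)))))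

far-markov : ∀ (D : Dist (Cube n)) t l →
  pairProb D (far n t) * (t ^ℚ 2 * ιℕ n) ^ℚ l ≤ 𝔼 D (λ x → 𝔼 D (λ y → ι (inner x y) ^ℚ (l ℕ.* 2)))
far-markov {n} D t l = begin
  pairProb D (far n t) * c                                  ≡⟨ sym (trans (𝔼-cong D (λ x → 𝔼-*ʳ D c _)) (𝔼-*ʳ D c _)) ⟩
  𝔼 D (λ x → 𝔼 D (λ y → ind (far n t x y) * c))            ≤⟨ 𝔼-mono-≤ D (λ x → 𝔼-mono-≤ D (λ y → pointwise x y)) ⟩
  𝔼 D (λ x → 𝔼 D (λ y → ι (inner x y) ^ℚ (l ℕ.* 2)))       ∎
  where
  open ℚ.≤-Reasoning
  c = (t ^ℚ 2 * ιℕ n) ^ℚ l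
  pointwise : ∀ x y → ind (far n t x y) * c ≤ ι (inner x y) ^ℚ (l ℕ.* 2)
  pointwise x y = ℚ.≤-trans (markov-≤ᵇ l (^2-nonneg (ι (inner x y))) (*-nonneg (^2-nonneg t) (ιℕ-nonneg n)))
                            (ℚ.≤-reflexive (sym (^-*2 (ι (inner x y)) l)))

far-dim0 : ∀ t (x y : Cube 0) → far 0 t x y ≡ false
far-dim0 t [] [] = cong (λ b → not (0ℚ ≤ᵇ b)) (ℚ.*-zeroʳ (t ^ℚ 2))

pairProb-far-≤ : ∀ n {φ} (dens : IsDensity n φ) l → KWiseUniform n (l ℕ.* 2) φ → ∀ t →
                 pairProb (cubeDist dens) (far n t) * t ^ℚ (l ℕ.* 2) ≤ ιℕ (matchings l)
-- For n = 0 the factor N ^ℚ l below cannot be cancelled, but then no pair is far.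
pairProb-far-≤ ℕ.zero dens l _ t = begin
  pairProb D (far 0 t) * t ^ℚ (l ℕ.* 2)   ≡⟨ cong (_* t ^ℚ (l ℕ.* 2)) q≡0 ⟩
  0ℚ * t ^ℚ (l ℕ.* 2)                     ≡⟨ ℚ.*-zeroˡ (t ^ℚ (l ℕ.* 2)) ⟩
  0ℚ                                      ≤⟨ ιℕ-nonneg (matchings l) ⟩
  ιℕ (matchings l)                        ∎
  where
  open ℚ.≤-Reasoning
  D = cubeDist dens
  q≡0 : pairProb D (far 0 t) ≡ 0ℚ
  q≡0 = trans (𝔼-cong D (λ x → trans (𝔼-cong D (λ y → cong ind (far-dim0 t x y))) (𝔼-const D 0ℚ))) (𝔼-const D 0ℚ)
pairProb-far-≤ n@(ℕ.suc _) dens l uniform t = ℚ.*-cancelʳ-≤-pos (N ^ℚ l) {{positive 0<Nˡ}} (begin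
  q * t ^ℚ (l ℕ.* 2) * N ^ℚ l               ≡⟨ ℚ.*-assoc q _ _ ⟩
  q * (t ^ℚ (l ℕ.* 2) * N ^ℚ l)             ≡⟨ cong (λ c → q * (c * N ^ℚ l)) (^-*2 t l) ⟩
  q * ((t ^ℚ 2) ^ℚ l * N ^ℚ l)              ≡⟨ cong (q *_) (sym (^-distribʳ-* (t ^ℚ 2) N l)) ⟩
  q * (t ^ℚ 2 * N) ^ℚ l                     ≤⟨ far-markov D t l ⟩
  𝔼 D (λ x → 𝔼 D (λ y → ι (inner x y) ^ℚ (l ℕ.* 2))) ≡⟨ 𝔼-inner-^-uniform dens uniform ⟩
  parityCount (l ℕ.* 2) ⊥                   ≤⟨ parityCount-⊥-≤ l ⟩
  ιℕ (matchings l) * N ^ℚ l                 ∎)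
  where
  open ℚ.≤-Reasoning
  D = cubeDist dens
  q = pairProb D (far n t)
  N = ιℕ n
  0<Nˡ : 0ℚ < N ^ℚ l
  0<Nˡ = ^-pos l (ℚ.<-≤-trans (ℚ.positive⁻¹ 1ℚ) (ιℕ-mono-≤ {1} {n} (ℕ.s≤s ℕ.z≤n)))

nine-tenths : ∀ {a q m c T} → 0ℚ < T → 1ℚ ≤ a + m * (m * q) → ιℕ 2 * (q * T) ≤ c → ιℕ 5 * c * m ^ℚ 2 ≤ T →
              (+ 9) /ℚ 10 ≤ a
nine-tenths {a} {q} {m} {c} {T} 0<T 1≤a+X 2qT≤c 5cm²≤T = begin
  (+ 9) /ℚ 10                                     ≡⟨ solve 2 (λ x y → x := (x :+ y) :- y) refl ((+ 9) /ℚ 10) X ⟩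
  ((+ 9) /ℚ 10 + X) - X                           ≤⟨ ℚ.+-monoˡ-≤ (- X) (ℚ.+-monoʳ-≤ ((+ 9) /ℚ 10) X≤1/10) ⟩
  ((+ 9) /ℚ 10 + (+ 1) /ℚ 10) - X                 ≤⟨ ℚ.+-monoˡ-≤ (- X) 1≤a+X ⟩
  (a + X) - X                                     ≡⟨ solve 2 (λ x y → (x :+ y) :- y := x) refl a X ⟩
  a                                               ∎
  where
  open ℚ.≤-Reasoning
  X = m * (m * q)
  T*10X≤T*1 : T * (ιℕ 10 * X) ≤ T * 1ℚ
  T*10X≤T*1 = begin
    T * (ιℕ 10 * X)                   ≡⟨ solve 3 (λ T m q → T :* (con (ιℕ 10) :* (m :* (m :* q)))
                                             := (con (ιℕ 5) :* (m :* (m :* con 1ℚ))) :* (con (ιℕ 2) :* (q :* T))) refl T m q ⟩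
    (ιℕ 5 * m ^ℚ 2) * (ιℕ 2 * (q * T)) ≤⟨ *-monoˡ-≤-nonneg (*-nonneg (ιℕ-nonneg 5) (^2-nonneg m)) 2qT≤c ⟩
    (ιℕ 5 * m ^ℚ 2) * c               ≡⟨ solve 2 (λ m c → (con (ιℕ 5) :* (m :* (m :* con 1ℚ))) :* c
                                             := con (ιℕ 5) :* c :* (m :* (m :* con 1ℚ))) refl m c ⟩
    ιℕ 5 * c * m ^ℚ 2                 ≤⟨ 5cm²≤T ⟩
    T                                 ≡⟨ sym (ℚ.*-identityʳ T) ⟩
    T * 1ℚ                            ∎
  X≤1/10 : X ≤ (+ 1) /ℚ 10
  X≤1/10 = begin
    X                                 ≡⟨ solve 1 (λ x → x := con ((+ 1) /ℚ 10) :* (con (ιℕ 10) :* x)) refl X ⟩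
    (+ 1) /ℚ 10 * (ιℕ 10 * X)         ≤⟨ ℚ.*-monoˡ-≤-nonNeg ((+ 1) /ℚ 10) (ℚ.*-cancelˡ-≤-pos T {{positive 0<T}} T*10X≤T*1) ⟩
    (+ 1) /ℚ 10 * 1ℚ                  ≡⟨ ℚ.*-identityʳ _ ⟩
    (+ 1) /ℚ 10                       ∎

lemma6 : (n k : ℕ) → 2 ∣ k → 0 <ℕ k →
         (φ : Cube n → ℚ) → IsDensity n φ → KWiseUniform n k φ →
         (m₁ : ℕ) (t : ℚ) → 0ℚ < t →
         ((+ (5 *ℕ (k ^ (k / 2)) *ℕ (m₁ ^ 2))) /ℚ 1) ≤ t ^ℚ k →
         ((+ 9) /ℚ 10) ≤ acceptProb n φ m₁ t
lemma6 n .(0 *ℕ 2) (divides ℕ.zero refl) ()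
lemma6 n .(ℕ.suc l *ℕ 2) (divides (ℕ.suc l) refl) _ φ dens uniform m t 0<t hyp =
  nine-tenths {q = q} {m = ιℕ m} (^-pos K 0<t) accept-or-far 2qtᵏ≤Kᴸ (subst (_≤ t ^ℚ K) casts hyp)
  where
  K = ℕ.suc l *ℕ 2
  D = cubeDist dens
  q = pairProb D (far n t)
  accept-or-far : 1ℚ ≤ acceptProb n φ m t + ιℕ m * (ιℕ m * q)
  accept-or-far = subst (λ p → 1ℚ ≤ p + ιℕ m * (ιℕ m * q)) (sym (acceptProb≡𝔼 dens m t)) (noPair-prob D (far n t) m)
  2qtᵏ≤Kᴸ : ιℕ 2 * (q * t ^ℚ K) ≤ ιℕ (K ^ ℕ.suc l)
  2qtᵏ≤Kᴸ = ℚ.≤-trans (*-monoˡ-≤-nonneg (ιℕ-nonneg 2) (pairProb-far-≤ n dens (ℕ.suc l) uniform t))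
             (ℚ.≤-trans (ℚ.≤-reflexive (sym (ιℕ-* 2 (matchings (ℕ.suc l))))) (ιℕ-mono-≤ (2*matchings≤ l)))
  casts : ιℕ (5 *ℕ K ^ (K / 2) *ℕ m ^ 2) ≡ ιℕ 5 * ιℕ (K ^ ℕ.suc l) * ιℕ m ^ℚ 2
  casts = begin
    ιℕ (5 *ℕ K ^ (K / 2) *ℕ m ^ 2)                 ≡⟨ cong (λ e → ιℕ (5 *ℕ K ^ e *ℕ m ^ 2)) (m*n/n≡m (ℕ.suc l) 2) ⟩
    ιℕ (5 *ℕ K ^ ℕ.suc l *ℕ m ^ 2)                 ≡⟨ ιℕ-* (5 *ℕ K ^ ℕ.suc l) (m ^ 2) ⟩
    ιℕ (5 *ℕ K ^ ℕ.suc l) * ιℕ (m ^ 2)             ≡⟨ cong₂ _*_ (ιℕ-* 5 (K ^ ℕ.suc l)) (ιℕ-^ m 2) ⟩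
    ιℕ 5 * ιℕ (K ^ ℕ.suc l) * ιℕ m ^ℚ 2            ∎
    where open ≡-Reasoning
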